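{- Let $l\geq 1$ and consider the path graph on vertices $v_0,\dots,v_l$, where $v_i$ and $v_j$ are adjacent iff $|i-j|=1$. Suppose each vertex is labeled with one of two colors. A move consists of choosing two adjacent vertices having the same color and changing the color of both of them. If either $l$ is even and $v_0,v_l$ have different colors, or $l$ is odd and $v_0,v_l$ have the same color, then there is a finite sequence of moves after which $v_0$ and $v_l$ have each changed color while every other vertex $v_i$ ($0<i<l$) has its original color. -}

module Defs where

open import Data.Nat using (ℕ; suc)
open import Data.Nat.Properties using (_≟_)
open import Data.Fin using (Fin; zero; suc; inject₁; fromℕ; toℕ)
open import Data.Bool using (Bool; not; if_then_else_)
open import Data.Product using (Σ; _×_)
open import Relation.Binary.PropositionalEquality using (_≡_)
open import Relation.Nullary.Decidable using (⌊_⌋)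

Colouring : ℕ → Set
Colouring l = Fin (suc l) → Bool

flipPair : ∀ {l} → Colouring l → Fin l → Colouring l
flipPair c i j =
  if ⌊ toℕ j ≟ toℕ i ⌋ then not (c j)
  else if ⌊ toℕ j ≟ suc (toℕ i) ⌋ then not (c j)
  else c j

data Move {l : ℕ} (c : Colouring l) : Colouring l → Set where
  move : (i : Fin l) → c (inject₁ i) ≡ c (suc i) → Move c (flipPair c i)

data Moves {l : ℕ} : Colouring l → Colouring l → Set where
  done : ∀ {c} → Moves c c
  step : ∀ {c d e} → Move c d → Moves d e → Moves c e

flipEnds : ∀ {l} → Colouring l → Colouring l
flipEnds {l} c j =
  if ⌊ toℕ j ≟ 0 ⌋ then not (c j)
  else if ⌊ toℕ j ≟ l ⌋ then not (c j)
  else c j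

-- Read each colour through the parity of its index, x_i = c_i xor (i odd).  A move is legal
-- exactly when x_i ≠ x_{i+1}, and it then swaps x_i and x_{i+1}; the hypothesis says x_0 ≠ x_l,
-- and flipping v_0 and v_l is the swap of x_0 and x_l.  Induct along the path: if v_0 and v_1
-- have the same colour, move there and then flip v_1 (back) and v_l on the path v_1 … v_l;
-- otherwise flip v_1 and v_l first, after which v_0 and v_1 have the same colour.
module Submission where

open import Defs
open import Data.Nat using (ℕ; zero; suc; _≥_; _%_; _≡ᵇ_)
open import Data.Nat.Properties using (_≟_)
open import Data.Fin using (Fin; zero; suc; fromℕ; toℕ)
open import Data.Bool using (Bool; true; not; _xor_; if_then_else_)
open import Data.Bool.Properties as Bool
  using (not-involutive; not-distribˡ-xor; not-distribʳ-xor; ¬-not)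
open import Data.Vec.Functional using (_∷_; head; tail)
open import Data.Sum using (_⊎_; inj₁; inj₂)
open import Data.Product using (Σ; _×_; _,_)
open import Function using (_∘_)
open import Relation.Nullary.Decidable using (⌊_⌋; yes; no; isYes≗does)
open import Relation.Binary.PropositionalEquality
  using (_≡_; _≢_; _≗_; refl; sym; trans; cong; cong₂; module ≡-Reasoning)

private variable
  l : ℕ
  b : Bool
  c c′ d g h : Colouring l

even : ℕ → Bool
even zero    = true
even (suc n) = not (even n)

even≡%2≡ᵇ0 : ∀ n → even n ≡ (n % 2 ≡ᵇ 0)
even≡%2≡ᵇ0 zero          = refl
even≡%2≡ᵇ0 (suc zero)    = refl
even≡%2≡ᵇ0 (suc (suc n)) = trans (not-involutive (even n)) (even≡%2≡ᵇ0 n)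

even-suc-xor-shift : ∀ n {x y z} → x ≡ even (suc n) xor y → z ≡ not y → x ≡ even n xor z
even-suc-xor-shift n {y = y} x≡ z≡ = begin
  _                   ≡⟨ x≡ ⟩
  not (even n) xor y  ≡⟨ sym (not-distribˡ-xor (even n) y) ⟩
  not (even n xor y)  ≡⟨ not-distribʳ-xor (even n) y ⟩
  even n xor not y    ≡⟨ cong (even n xor_) (sym z≡) ⟩
  _                   ∎
  where open ≡-Reasoning

ends-from-%2 : (c : Colouring l) →
               (l % 2 ≡ 0 × c zero ≢ c (fromℕ l)) ⊎ (l % 2 ≡ 1 × c zero ≡ c (fromℕ l)) →
               c (fromℕ l) ≡ even l xor c zero
ends-from-%2 {l} c (inj₁ (l%2≡0 , differ)) rewrite even≡%2≡ᵇ0 l | l%2≡0 = ¬-not (differ ∘ sym)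
ends-from-%2 {l} c (inj₂ (l%2≡1 , same))   rewrite even≡%2≡ᵇ0 l | l%2≡1 = sym same

-- ⌊_⌋ matches on the decision, so it does not compute this by itself.
⌊suc≟suc⌋ : ∀ m n → ⌊ suc m ≟ suc n ⌋ ≡ ⌊ m ≟ n ⌋
⌊suc≟suc⌋ m n = trans (isYes≗does (suc m ≟ suc n)) (sym (isYes≗does (m ≟ n)))

flipHead : Colouring l → Colouring l
flipHead c = not (head c) ∷ tail c

flipPair-cong : c ≗ c′ → ∀ i → flipPair c i ≗ flipPair c′ i
flipPair-cong c≗c′ i j =
  cong (λ x → if ⌊ toℕ j ≟ toℕ i ⌋ then not x
              else if ⌊ toℕ j ≟ suc (toℕ i) ⌋ then not x else x)
       (c≗c′ j)

flipPair-zero : (c : Colouring (suc l)) → flipPair c zero ≗ not (head c) ∷ flipHead (tail c)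
flipPair-zero c zero          = refl
flipPair-zero c (suc zero)    = refl
flipPair-zero c (suc (suc j)) = refl

flipPair-suc : (t : Colouring l) (i : Fin l) → flipPair (b ∷ t) (suc i) ≗ b ∷ flipPair t i
flipPair-suc t i zero    = refl
flipPair-suc t i (suc j) =
  cong₂ (λ p q → if p then not (t j) else if q then not (t j) else t j)
        (⌊suc≟suc⌋ (toℕ j) (toℕ i)) (⌊suc≟suc⌋ (toℕ j) (suc (toℕ i)))

∷-head-tail : (c : Colouring (suc l)) → c ≗ head c ∷ tail c
∷-head-tail c zero    = refl
∷-head-tail c (suc j) = refl

∷-cong : c ≗ c′ → b ∷ c ≗ b ∷ c′
∷-cong c≗c′ zero    = refl
∷-cong c≗c′ (suc j) = c≗c′ j

flipPair≗flipEnds : (c : Colouring 1) → flipPair c zero ≗ flipEnds c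
flipPair≗flipEnds c zero       = refl
flipPair≗flipEnds c (suc zero) = refl

flipEnds-move₀-first : (c : Colouring (suc (suc l))) →
                       not (head c) ∷ flipEnds (flipHead (tail c)) ≗ flipEnds c
flipEnds-move₀-first c zero          = refl
flipEnds-move₀-first c (suc zero)    = not-involutive (c (suc zero))
flipEnds-move₀-first {l = l} c (suc (suc j)) =
  cong (λ p → if p then not (c (suc (suc j))) else c (suc (suc j)))
       (sym (⌊suc≟suc⌋ (suc (toℕ j)) (suc l)))

flipEnds-move₀-last : (c : Colouring (suc (suc l))) →
                      flipPair (head c ∷ flipEnds (tail c)) zero ≗ flipEnds c
flipEnds-move₀-last c zero          = refl
flipEnds-move₀-last c (suc zero)    = not-involutive (c (suc zero))
flipEnds-move₀-last {l = l} c (suc (suc j)) =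
  cong (λ p → if p then not (c (suc (suc j))) else c (suc (suc j)))
       (sym (⌊suc≟suc⌋ (suc (toℕ j)) (suc l)))

-- Colourings are functions, equal only pointwise, so reachability is taken up to _≗_.
infix 4 _⇝_
_⇝_ : Colouring l → Colouring l → Set
c ⇝ g = Σ (Colouring _) (λ d → Moves c d × d ≗ g)

⇝-step : Move c d → d ⇝ g → c ⇝ g
⇝-step mv (e , ms , e≗g) = e , step mv ms , e≗g

Moves-⇝-trans : Moves c d → d ⇝ g → c ⇝ g
Moves-⇝-trans done         r = r
Moves-⇝-trans (step mv ms) r = ⇝-step mv (Moves-⇝-trans ms r)

⇝-respʳ : c ⇝ g → g ≗ h → c ⇝ h
⇝-respʳ (d , ms , d≗g) g≗h = d , ms , λ j → trans (d≗g j) (g≗h j)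

Moves-respˡ : c′ ≗ c → Moves c d → c′ ⇝ d
Moves-respˡ c′≗c done = _ , done , c′≗c
Moves-respˡ c′≗c (step (move i same) ms) =
  ⇝-step (move i (trans (c′≗c _) (trans same (sym (c′≗c _)))))
         (Moves-respˡ (flipPair-cong c′≗c i) ms)

⇝-respˡ : c′ ≗ c → c ⇝ g → c′ ⇝ g
⇝-respˡ c′≗c (d , ms , d≗g) = ⇝-respʳ (Moves-respˡ c′≗c ms) d≗g

⇝-trans : c ⇝ g → g ⇝ h → c ⇝ h
⇝-trans (d , ms , d≗g) g⇝h = Moves-⇝-trans ms (⇝-respˡ d≗g g⇝h)

move⇝ : Move c d → d ≗ g → c ⇝ g
move⇝ mv d≗g = _ , step mv done , d≗g

∷-Moves : {t d : Colouring l} → Moves t d → b ∷ t ⇝ b ∷ d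
∷-Moves done = _ , done , λ _ → refl
∷-Moves (step (move i same) ms) =
  ⇝-step (move (suc i) same) (⇝-respˡ (flipPair-suc _ i) (∷-Moves ms))

∷-⇝ : {t g : Colouring l} → t ⇝ g → b ∷ t ⇝ b ∷ g
∷-⇝ (d , ms , d≗g) = ⇝-respʳ (∷-Moves ms) (∷-cong d≗g)

flipEnds-reachable : ∀ m (c : Colouring (suc m)) →
                     c (fromℕ (suc m)) ≡ even (suc m) xor c zero → c ⇝ flipEnds c
flipEnds-reachable zero c ends =
  move⇝ (move zero (sym ends)) (flipPair≗flipEnds c)
flipEnds-reachable (suc m) c ends with c zero Bool.≟ c (suc zero)
... | yes same =
  ⇝-step (move zero same)
    (⇝-respˡ (flipPair-zero c)
      (⇝-respʳ (∷-⇝ (flipEnds-reachable m (flipHead (tail c))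
                                         (even-suc-xor-shift (suc m) ends (cong not (sym same)))))
               (flipEnds-move₀-first c)))
... | no differ =
  ⇝-respˡ (∷-head-tail c)
    (⇝-trans (∷-⇝ (flipEnds-reachable m (tail c)
                                       (even-suc-xor-shift (suc m) ends (¬-not (differ ∘ sym)))))
             (move⇝ (move zero (¬-not differ)) (flipEnds-move₀-last c)))

lemma11 : (l : ℕ) → l ≥ 1 → (c : Colouring l) →
    ((l % 2 ≡ 0 × c zero ≢ c (fromℕ l)) ⊎ (l % 2 ≡ 1 × c zero ≡ c (fromℕ l))) →
    Σ (Colouring l) (λ d → Moves c d × (∀ j → d j ≡ flipEnds c j))
lemma11 (suc m) _ c parity = flipEnds-reachable m c (ends-from-%2 c parity)
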